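{- For $t\in\mathbb{Q}$ put $$x_1(t)=\frac{2t^2-22t-13}{14(t^2+t+1)},\quad x_2(t)=\frac{ -13t^2-4t+11}{14(t^2+t+1)},\quad x_3(t)=\frac{11t^2+26t+2}{14(t^2+t+1)}.$$ The $5$-designs with $6$ rational points for the Chebyshev measure $(1-t^2)^{ -1/2}dt/\pi$ on $(-1,1)$ are parametrized by these rational functions: every such design is, as a set, $\{\pm x_1(t),\pm x_2(t),\pm x_3(t)\}$ for some $t\in\mathbb{Q}$, and for every $t\in\mathbb{Q}$ the six numbers $x_1(t),x_2(t),x_3(t),-x_1(t),-x_2(t),-x_3(t)$ form such a design whenever they are pairwise distinct.
   Context: An $m$-design with $n$ points for a probability measure $w(t)dt$ on an interval $I$ is a set of $n$ pairwise distinct points $x_1,\dots,x_n\in I$ with $\frac1n\sum_i f(x_i)=\int_I f(t)w(t)dt$ for every real polynomial $f$ of degree at most $m$. The Chebyshev measure is $w(t)=\frac{1}{\pi\sqrt{1-t^2}}$ on $I=(-1,1)$. -}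

module Defs where

open import Data.Nat as ℕ using (ℕ; zero; suc)
open import Data.Integer as ℤ using (ℤ; +_; -_)
open import Data.Rational as ℚ using (ℚ; 0ℚ; 1ℚ; _+_; _*_; _÷_; _<_; ≢-nonZero)
open import Data.Rational.Properties using (_≟_)
open import Data.List using (List; []; _∷_; length)
open import Data.Fin using (Fin) renaming (zero to fzero; suc to fsuc)
open import Data.Vec using (Vec; []; _∷_; lookup)
open import Data.Product using (_×_; ∃)
open import Relation.Nullary using (yes; no)
open import Relation.Binary.PropositionalEquality using (_≡_)

ℤq : ℤ → ℚ
ℤq z = z ℚ./ 1

ℕq : ℕ → ℚ
ℕq n = ℤq (+ n)

-- division on ℚ, total (x / 0 := 0); only ever used with nonzero divisors
infixl 7 _/q_
_/q_ : ℚ → ℚ → ℚ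
p /q q with q ≟ 0ℚ
... | yes _ = 0ℚ
... | no q≢0 = _÷_ p q {{≢-nonZero q≢0}}

-- Polynomials: coefficient lists, constant term first.
-- degree ≤ m  ⇔  length ≤ m + 1
Poly : Set
Poly = List ℚ

eval : Poly → ℚ → ℚ
eval []       x = 0ℚ
eval (c ∷ cs) x = c + x * eval cs x

-- Moments μ k = ∫_{-1}^{1} t^k (1/(π √(1-t²))) dt of the Chebyshev measure:
-- μ 0 = 1, μ 1 = 0, μ (k+2) = μ k · (k+1)/(k+2)   (so μ (2j) = C(2j,j)/4^j)
chebMoment : ℕ → ℚ
chebMoment zero          = 1ℚ
chebMoment (suc zero)    = 0ℚ
chebMoment (suc (suc k)) = chebMoment k * (+ (suc k) ℚ./ suc (suc k))

-- ∫ t^k f(t) w(t) dt for the Chebyshev measure (by linearity from the moments)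
chebIntFrom : ℕ → Poly → ℚ
chebIntFrom k []       = 0ℚ
chebIntFrom k (c ∷ cs) = c * chebMoment k + chebIntFrom (suc k) cs

chebInt : Poly → ℚ
chebInt = chebIntFrom 0

sumFin : (n : ℕ) → (Fin n → ℚ) → ℚ
sumFin zero    f = 0ℚ
sumFin (suc n) f = f fzero + sumFin n (λ i → f (fsuc i))

PairwiseDistinct : {n : ℕ} → (Fin n → ℚ) → Set
PairwiseDistinct x = ∀ i j → x i ≡ x j → i ≡ j

IsChebDesign : (m n : ℕ) → (Fin n → ℚ) → Set
IsChebDesign m n x =
  (∀ i → (ℤq (- (+ 1)) < x i) × (x i < 1ℚ)) ×
  PairwiseDistinct x ×
  (∀ (f : Poly) → length f ℕ.≤ suc m →
     sumFin n (λ i → eval f (x i)) /q ℕq n ≡ chebInt f)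

SameSet : {n k : ℕ} → (Fin n → ℚ) → (Fin k → ℚ) → Set
SameSet x y = (∀ i → ∃ λ j → x i ≡ y j) × (∀ j → ∃ λ i → x i ≡ y j)

den : ℚ → ℚ
den t = ℕq 14 * (t * t + t + 1ℚ)

x₁ x₂ x₃ : ℚ → ℚ
x₁ t = (ℕq 2 * (t * t) + ℤq (- (+ 22)) * t + ℤq (- (+ 13))) /q den t
x₂ t = (ℤq (- (+ 13)) * (t * t) + ℤq (- (+ 4)) * t + ℕq 11) /q den t
x₃ t = (ℕq 11 * (t * t) + ℕq 26 * t + ℕq 2) /q den t

sixPoints : ℚ → Fin 6 → ℚ
sixPoints t = lookup (x₁ t ∷ x₂ t ∷ x₃ t ∷ ℚ.- x₁ t ∷ ℚ.- x₂ t ∷ ℚ.- x₃ t ∷ [])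

{-# OPTIONS --safe #-}
module Submission where

-- For six points the power sums p₁, …, p₅ determine ∏ (y − xᵢ) up to its
-- constant term (Newton–Girard); for the Chebyshev moments this product is
-- Y³ − (3/2) Y² + (9/16) Y + e₆ with Y = y².  So a design consists of the
-- points ±a, ±b, ±c, where a², b², c² are the roots of this cubic:
-- a² + b² + c² = 3/2 and a²b² + b²c² + c²a² = 9/16.  By Heron's identity the
-- second condition makes (a + b + c)(−a + b + c)(a − b + c)(a + b − c)
-- vanish, so after changing signs (a, b, c) is a rational point of the conic
-- a + b + c = 0, a² + b² + c² = 3/2, which x₁, x₂, x₃ parametrise by
-- projection from (1/7, −13/14, 11/14).  Conversely every point of the conic
-- satisfies both conditions, and 3a² + (b − c)² = 3 puts a in (−1, 1) as
-- soon as b ≠ c.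

open import Defs
open import Data.Rational using (ℚ)
open import Data.Fin using (Fin)
open import Data.Product using (_×_; ∃)

open import Algebra.Bundles using (CommutativeMonoid)
open import Data.Fin using (zero; suc; #_; _↑ˡ_; _↑ʳ_)
open import Data.Fin.Properties using (any?; ¬∀⟶∃¬; injective⇒≤)
open import Data.Integer as ℤ using (+_)
open import Data.List using (List; []; _∷_; length)
open import Data.Nat as ℕ using (ℕ; zero; suc; z≤n; s≤s)
import Data.Nat.Properties as ℕP
open import Data.Product using (_,_; proj₁; proj₂; map₂)
open import Data.Rational
  using (0ℚ; 1ℚ; _+_; _*_; -_; _-_; _/_; _<_; _≤_; 1/_; NonZero; ≢-nonZero;
         positive; negative; nonNegative; nonPositive)
import Data.Rational.Properties as ℚP
open import Data.Rational.Properties using (_≟_)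
open import Data.Sum using (_⊎_; inj₁; inj₂; [_,_]′; reduce)
open import Data.Vec using (lookup) renaming ([] to []ᵛ; _∷_ to _∷ᵛ_)
open import Data.Vec.Functional using (_++_)
open import Data.Vec.Functional.Properties using (lookup-++ˡ; lookup-++ʳ)
open import Function using (_∘_)
open import Relation.Binary.Definitions using (tri<; tri≈; tri>)
open import Relation.Binary.PropositionalEquality
open import Relation.Nullary using (¬_; Dec; yes; no; contradiction)
open import Relation.Nullary.Decidable using (dec⇒maybe)
open import Tactic.RingSolver using (solve-∀; solve)
open import Tactic.RingSolver.Core.AlmostCommutativeRing
  using (AlmostCommutativeRing; fromCommutativeRing)

open import Algebra.Properties.Group ℚP.+-0-group
  using (x∙y⁻¹≈ε⇒x≈y; x≈y⇒x∙y⁻¹≈ε; inverseˡ-unique; inverseʳ-unique; ⁻¹-involutive)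
open import Algebra.Properties.CommutativeSemigroup
  (CommutativeMonoid.commutativeSemigroup ℚP.+-0-commutativeMonoid)
  using () renaming (interchange to +-interchange)
open ≡-Reasoning

ℚring : AlmostCommutativeRing _ _
ℚring = fromCommutativeRing ℚP.+-*-commutativeRing (λ p → dec⇒maybe (0ℚ ≟ p))

open AlmostCommutativeRing ℚring using (_^_; semiring)
open import Algebra.Properties.Semiring.Exp.TCOptimised semiring using (^-homo-*)

p-q≡0⇒p≡q : ∀ {p q} → p - q ≡ 0ℚ → p ≡ q
p-q≡0⇒p≡q = x∙y⁻¹≈ε⇒x≈y _ _

1/p*[p*q]≡q : ∀ p q .{{_ : NonZero p}} → 1/ p * (p * q) ≡ q
1/p*[p*q]≡q p q = begin
  1/ p * (p * q)  ≡⟨ ℚP.*-assoc (1/ p) p q ⟨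
  1/ p * p * q    ≡⟨ cong (_* q) (ℚP.*-inverseˡ p) ⟩
  1ℚ * q          ≡⟨ ℚP.*-identityˡ q ⟩
  q               ∎

*-cancelˡ-≢0 : ∀ {c p q} → c ≢ 0ℚ → c * p ≡ c * q → p ≡ q
*-cancelˡ-≢0 {c} {p} {q} c≢0 cp≡cq = begin
  p               ≡⟨ 1/p*[p*q]≡q c p ⟨
  1/ c * (c * p)  ≡⟨ cong (1/ c *_) cp≡cq ⟩
  1/ c * (c * q)  ≡⟨ 1/p*[p*q]≡q c q ⟩
  q               ∎
  where instance _ = ≢-nonZero c≢0

p*q≡0⇒p≡0⊎q≡0 : ∀ p q → p * q ≡ 0ℚ → p ≡ 0ℚ ⊎ q ≡ 0ℚ
p*q≡0⇒p≡0⊎q≡0 p q pq≡0 with p ≟ 0ℚ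
... | yes p≡0 = inj₁ p≡0
... | no p≢0  = inj₂ (*-cancelˡ-≢0 p≢0 (trans pq≡0 (sym (ℚP.*-zeroʳ p))))

p≢0∧q≢0⇒p*q≢0 : ∀ {p q} → p ≢ 0ℚ → q ≢ 0ℚ → p * q ≢ 0ℚ
p≢0∧q≢0⇒p*q≢0 {p} {q} p≢0 q≢0 = [ p≢0 , q≢0 ]′ ∘ p*q≡0⇒p≡0⊎q≡0 p q

-p*-p≡p*p : ∀ p → (- p) * (- p) ≡ p * p
-p*-p≡p*p = solve-∀ ℚring

p*p≡q*q⇒p≡±q : ∀ {p q} → p * p ≡ q * q → p ≡ q ⊎ p ≡ - q
p*p≡q*q⇒p≡±q {p} {q} p²≡q² =
  [ inj₁ ∘ p-q≡0⇒p≡q , inj₂ ∘ p-q≡0⇒p≡q ]′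
    (p*q≡0⇒p≡0⊎q≡0 (p - q) (p - - q) product≡0)
  where
  product≡0 : (p - q) * (p - - q) ≡ 0ℚ
  product≡0 = begin
    (p - q) * (p - - q)  ≡⟨ solve (p ∷ q ∷ []) ℚring ⟩
    p * p - q * q        ≡⟨ x≈y⇒x∙y⁻¹≈ε p²≡q² ⟩
    0ℚ                   ∎

d*[p/d]≡p : ∀ p {d} → d ≢ 0ℚ → d * (p /q d) ≡ p
d*[p/d]≡p p {d} d≢0 with d ≟ 0ℚ
... | yes d≡0 = contradiction d≡0 d≢0
... | no d≢0′ = begin
  d * (p * 1/ d)  ≡⟨ cong (d *_) (ℚP.*-comm p (1/ d)) ⟩
  d * (1/ d * p)  ≡⟨ ℚP.*-assoc d (1/ d) p ⟨
  d * 1/ d * p    ≡⟨ cong (_* p) (ℚP.*-inverseʳ d) ⟩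
  1ℚ * p          ≡⟨ ℚP.*-identityˡ p ⟩
  p               ∎
  where instance _ = ≢-nonZero d≢0′

≡*⇒/q≡ : ∀ {p d v} → d ≢ 0ℚ → p ≡ d * v → p /q d ≡ v
≡*⇒/q≡ {p} d≢0 p≡dv = *-cancelˡ-≢0 d≢0 (trans (d*[p/d]≡p p d≢0) p≡dv)

/q≡⇒≡* : ∀ {p d v} → d ≢ 0ℚ → p /q d ≡ v → p ≡ d * v
/q≡⇒≡* {p} d≢0 refl = sym (d*[p/d]≡p p d≢0)

0≤p*p : ∀ p → 0ℚ ≤ p * p
0≤p*p p with ℚP.≤-total 0ℚ p
... | inj₁ 0≤p = ℚP.nonNegative⁻¹ _
                   {{ℚP.nonNeg*nonNeg⇒nonNeg p {{nonNegative 0≤p}} p {{nonNegative 0≤p}}}}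
... | inj₂ p≤0 = ℚP.nonNegative⁻¹ _
                   {{ℚP.nonPos*nonPos⇒nonPos p {{nonPositive p≤0}} p {{nonPositive p≤0}}}}

0<p*p : ∀ {p} → p ≢ 0ℚ → 0ℚ < p * p
0<p*p {p} p≢0 with ℚP.<-cmp p 0ℚ
... | tri< p<0 _ _ = ℚP.positive⁻¹ _ {{ℚP.neg*neg⇒pos p {{negative p<0}} p {{negative p<0}}}}
... | tri≈ _ p≡0 _ = contradiction p≡0 p≢0
... | tri> _ _ p>0 = ℚP.positive⁻¹ _ {{ℚP.pos*pos⇒pos p {{positive p>0}} p {{positive p>0}}}}

p*p<1⇒p<1 : ∀ {p} → p * p < 1ℚ → p < 1ℚ
p*p<1⇒p<1 {p} p*p<1 with p ℚP.<? 1ℚ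
... | yes p<1 = p<1
... | no p≮1  = contradiction (ℚP.≤-<-trans 1≤p*p p*p<1) (ℚP.<-irrefl refl)
  where
  1≤p : 1ℚ ≤ p
  1≤p = ℚP.≮⇒≥ p≮1
  1≤p*p : 1ℚ ≤ p * p
  1≤p*p = ℚP.≤-trans 1≤p (subst (_≤ p * p) (ℚP.*-identityˡ p)
            (ℚP.*-monoʳ-≤-nonNeg p {{nonNegative (ℚP.≤-trans (ℚP.nonNegative⁻¹ 1ℚ) 1≤p)}} 1≤p))

InUnitInterval : ℚ → Set
InUnitInterval p = (ℤq (ℤ.- (+ 1)) < p) × (p < 1ℚ)

p*p<1⇒inUnitInterval : ∀ {p} → p * p < 1ℚ → InUnitInterval p
p*p<1⇒inUnitInterval {p} p*p<1 =
  subst (ℤq (ℤ.- (+ 1)) <_) (⁻¹-involutive p)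
        (ℚP.neg-antimono-< (p*p<1⇒p<1 (subst (_< 1ℚ) (sym (-p*-p≡p*p p)) p*p<1))) ,
  p*p<1⇒p<1 p*p<1

neg-inUnitInterval : ∀ {p} → InUnitInterval p → InUnitInterval (- p)
neg-inUnitInterval (-1<p , p<1) = ℚP.neg-antimono-< p<1 , ℚP.neg-antimono-< -1<p

prodFin : (n : ℕ) → (Fin n → ℚ) → ℚ
prodFin zero    f = 1ℚ
prodFin (suc n) f = f zero * prodFin n (f ∘ suc)

sumFin-cong : ∀ n {f g : Fin n → ℚ} → (∀ i → f i ≡ g i) → sumFin n f ≡ sumFin n g
sumFin-cong zero    f≗g = refl
sumFin-cong (suc n) f≗g = cong₂ _+_ (f≗g zero) (sumFin-cong n (f≗g ∘ suc))

sumFin-zero : ∀ n → sumFin n (λ _ → 0ℚ) ≡ 0ℚ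
sumFin-zero zero    = refl
sumFin-zero (suc n) = trans (ℚP.+-identityˡ _) (sumFin-zero n)

sumFin-+ : ∀ n (f g : Fin n → ℚ) → sumFin n (λ i → f i + g i) ≡ sumFin n f + sumFin n g
sumFin-+ zero    f g = refl
sumFin-+ (suc n) f g = begin
  (f zero + g zero) + sumFin n (λ i → f (suc i) + g (suc i))
    ≡⟨ cong (_+_ (f zero + g zero)) (sumFin-+ n (f ∘ suc) (g ∘ suc)) ⟩
  (f zero + g zero) + (sumFin n (f ∘ suc) + sumFin n (g ∘ suc))
    ≡⟨ +-interchange (f zero) (g zero) _ _ ⟩
  (f zero + sumFin n (f ∘ suc)) + (g zero + sumFin n (g ∘ suc))
    ∎

sumFin-*ˡ : ∀ n c (f : Fin n → ℚ) → sumFin n (λ i → c * f i) ≡ c * sumFin n f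
sumFin-*ˡ zero    c f = sym (ℚP.*-zeroʳ c)
sumFin-*ˡ (suc n) c f = begin
  c * f zero + sumFin n (λ i → c * f (suc i))
    ≡⟨ cong (_+_ (c * f zero)) (sumFin-*ˡ n c (f ∘ suc)) ⟩
  c * f zero + c * sumFin n (f ∘ suc)
    ≡⟨ ℚP.*-distribˡ-+ c _ _ ⟨
  c * (f zero + sumFin n (f ∘ suc))
    ∎

prodFin≡0⇒∃≡0 : ∀ n (f : Fin n → ℚ) → prodFin n f ≡ 0ℚ → ∃ λ i → f i ≡ 0ℚ
prodFin≡0⇒∃≡0 zero    f 1≡0 = contradiction 1≡0 λ ()
prodFin≡0⇒∃≡0 (suc n) f ∏≡0 with p*q≡0⇒p≡0⊎q≡0 (f zero) _ ∏≡0
... | inj₁ f0≡0 = zero , f0≡0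
... | inj₂ ∏′≡0 = let i , fi≡0 = prodFin≡0⇒∃≡0 n (f ∘ suc) ∏′≡0 in suc i , fi≡0

≡0⇒prodFin≡0 : ∀ n (f : Fin n → ℚ) i → f i ≡ 0ℚ → prodFin n f ≡ 0ℚ
≡0⇒prodFin≡0 (suc n) f zero    fi≡0 =
  trans (cong (_* prodFin n (f ∘ suc)) fi≡0) (ℚP.*-zeroˡ (prodFin n (f ∘ suc)))
≡0⇒prodFin≡0 (suc n) f (suc i) fi≡0 =
  trans (cong (f zero *_) (≡0⇒prodFin≡0 n (f ∘ suc) i fi≡0)) (ℚP.*-zeroʳ (f zero))

-- Exact integration versus moments

powerSum : (n : ℕ) → (Fin n → ℚ) → ℕ → ℚ
powerSum n x k = sumFin n (λ i → x i ^ k)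

MatchesChebMoments : ℕ → (n : ℕ) → (Fin n → ℚ) → Set
MatchesChebMoments m n x = ∀ k → k ℕ.≤ m → powerSum n x k ≡ ℕq n * chebMoment k

IntegratesExactly : ℕ → (n : ℕ) → (Fin n → ℚ) → Set
IntegratesExactly m n x =
  ∀ f → length f ℕ.≤ suc m → sumFin n (λ i → eval f (x i)) ≡ ℕq n * chebInt f

monomial : ℕ → Poly
monomial zero    = 1ℚ ∷ []
monomial (suc k) = 0ℚ ∷ monomial k

length-monomial : ∀ k → length (monomial k) ≡ suc k
length-monomial zero    = refl
length-monomial (suc k) = cong suc (length-monomial k)

^-suc : ∀ y k → y ^ suc k ≡ y * y ^ k
^-suc y k = ^-homo-* y 1 k

eval-monomial : ∀ k y → eval (monomial k) y ≡ y ^ k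
eval-monomial zero    y = trans (cong (_+_ 1ℚ) (ℚP.*-zeroʳ y)) (ℚP.+-identityʳ 1ℚ)
eval-monomial (suc k) y = begin
  0ℚ + y * eval (monomial k) y  ≡⟨ ℚP.+-identityˡ _ ⟩
  y * eval (monomial k) y       ≡⟨ cong (y *_) (eval-monomial k y) ⟩
  y * y ^ k                     ≡⟨ ^-suc y k ⟨
  y ^ suc k                     ∎

chebIntFrom-monomial : ∀ k j → chebIntFrom j (monomial k) ≡ chebMoment (k ℕ.+ j)
chebIntFrom-monomial zero    j = trans (ℚP.+-identityʳ _) (ℚP.*-identityˡ _)
chebIntFrom-monomial (suc k) j = begin
  0ℚ * chebMoment j + chebIntFrom (suc j) (monomial k)
    ≡⟨ cong₂ _+_ (ℚP.*-zeroˡ (chebMoment j)) (chebIntFrom-monomial k (suc j)) ⟩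
  0ℚ + chebMoment (k ℕ.+ suc j)
    ≡⟨ ℚP.+-identityˡ _ ⟩
  chebMoment (k ℕ.+ suc j)
    ≡⟨ cong chebMoment (ℕP.+-suc k j) ⟩
  chebMoment (suc k ℕ.+ j)
    ∎

integratesExactly⇒moments : ∀ {m n x} → IntegratesExactly m n x → MatchesChebMoments m n x
integratesExactly⇒moments {m} {n} {x} exact k k≤m = begin
  sumFin n (λ i → x i ^ k)
    ≡⟨ sumFin-cong n (λ i → eval-monomial k (x i)) ⟨
  sumFin n (λ i → eval (monomial k) (x i))
    ≡⟨ exact (monomial k) (subst (ℕ._≤ suc m) (sym (length-monomial k)) (s≤s k≤m)) ⟩
  ℕq n * chebIntFrom 0 (monomial k)
    ≡⟨ cong (λ μ → ℕq n * μ) (chebIntFrom-monomial k 0) ⟩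
  ℕq n * chebMoment (k ℕ.+ 0)
    ≡⟨ cong (λ j → ℕq n * chebMoment j) (ℕP.+-identityʳ k) ⟩
  ℕq n * chebMoment k
    ∎

moments⇒integratesExactly : ∀ {m n x} → MatchesChebMoments m n x → IntegratesExactly m n x
moments⇒integratesExactly {m} {n} {x} moments f len = begin
  sumFin n (λ i → eval f (x i))
    ≡⟨ sumFin-cong n (λ i → ℚP.*-identityˡ _) ⟨
  sumFin n (λ i → x i ^ 0 * eval f (x i))
    ≡⟨ shifted 0 f (subst (ℕ._≤ suc m) (sym (ℕP.+-identityʳ _)) len) ⟩
  ℕq n * chebIntFrom 0 f
    ∎
  where
  distrib : ∀ p c y e → p * (c + y * e) ≡ c * p + y * p * e
  distrib = solve-∀ ℚring

  regroup : ∀ c N μ I → c * (N * μ) + N * I ≡ N * (c * μ + I)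
  regroup = solve-∀ ℚring

  split : ∀ y j c e → y ^ j * (c + y * e) ≡ c * y ^ j + y ^ suc j * e
  split y j c e = begin
    y ^ j * (c + y * e)        ≡⟨ distrib (y ^ j) c y e ⟩
    c * y ^ j + y * y ^ j * e  ≡⟨ cong (λ z → c * y ^ j + z * e) (^-suc y j) ⟨
    c * y ^ j + y ^ suc j * e  ∎

  shifted : ∀ j f → length f ℕ.+ j ℕ.≤ suc m →
            sumFin n (λ i → x i ^ j * eval f (x i)) ≡ ℕq n * chebIntFrom j f
  shifted j [] _ = begin
    sumFin n (λ i → x i ^ j * 0ℚ)  ≡⟨ sumFin-cong n (λ i → ℚP.*-zeroʳ (x i ^ j)) ⟩
    sumFin n (λ _ → 0ℚ)            ≡⟨ sumFin-zero n ⟩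
    0ℚ                             ≡⟨ ℚP.*-zeroʳ (ℕq n) ⟨
    ℕq n * 0ℚ                      ∎
  shifted j (c ∷ cs) (s≤s len) = begin
    sumFin n (λ i → x i ^ j * (c + x i * eval cs (x i)))
      ≡⟨ sumFin-cong n (λ i → split (x i) j c (eval cs (x i))) ⟩
    sumFin n (λ i → c * x i ^ j + x i ^ suc j * eval cs (x i))
      ≡⟨ sumFin-+ n _ _ ⟩
    sumFin n (λ i → c * x i ^ j) + sumFin n (λ i → x i ^ suc j * eval cs (x i))
      ≡⟨ cong₂ _+_ (sumFin-*ˡ n c _) (shifted (suc j) cs len′) ⟩
    c * powerSum n x j + ℕq n * chebIntFrom (suc j) cs
      ≡⟨ cong (λ s → c * s + ℕq n * chebIntFrom (suc j) cs) (moments j j≤m) ⟩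
    c * (ℕq n * chebMoment j) + ℕq n * chebIntFrom (suc j) cs
      ≡⟨ regroup c (ℕq n) (chebMoment j) (chebIntFrom (suc j) cs) ⟩
    ℕq n * (c * chebMoment j + chebIntFrom (suc j) cs)
      ∎
    where
    len′ : length cs ℕ.+ suc j ℕ.≤ suc m
    len′ = subst (ℕ._≤ suc m) (sym (ℕP.+-suc (length cs) j)) (s≤s len)
    j≤m : j ℕ.≤ m
    j≤m = ℕP.≤-trans (ℕP.m≤n+m j (length cs)) len

design⇒moments : ∀ {m x} → IsChebDesign m 6 x → MatchesChebMoments m 6 x
design⇒moments {m} {x} (_ , _ , averages) =
  integratesExactly⇒moments {m} {6} {x} λ f len →
    /q≡⇒≡* {sumFin 6 (λ i → eval f (x i))} {ℕq 6} {chebInt f} (λ ()) (averages f len)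

moments⇒averages : ∀ {m x} → MatchesChebMoments m 6 x →
  ∀ f → length f ℕ.≤ suc m → sumFin 6 (λ i → eval f (x i)) /q ℕq 6 ≡ chebInt f
moments⇒averages {m} {x} moments f len =
  ≡*⇒/q≡ {sumFin 6 (λ i → eval f (x i))} {ℕq 6} {chebInt f} (λ ())
    (moments⇒integratesExactly {m} {6} {x} moments f len)

-- The vanishing polynomial of a six-point 5-design

-- Newton–Girard for six variables, scaled by 6! to clear denominators.  The
-- power sums enter as equations so that the ring solver sees them expanded;
-- they are shaped like sumFin, so that powerSum 6 x k unfolds to p k.
newton-six : ∀ {p₁ p₂ p₃ p₄ p₅ : ℚ} a b c d e f y →
  let p : ℕ → ℚ
      p k = a ^ k + (b ^ k + (c ^ k + (d ^ k + (e ^ k + (f ^ k + 0ℚ)))))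
  in p 1 ≡ p₁ → p 2 ≡ p₂ → p 3 ≡ p₃ → p 4 ≡ p₄ → p 5 ≡ p₅ →
     ℕq 720 * ((y - a) * ((y - b) * ((y - c) * ((y - d) * ((y - e) * ((y - f) * 1ℚ)))))) ≡
       ℕq 720 * y ^ 6 - ℕq 720 * p₁ * y ^ 5 + ℕq 360 * (p₁ ^ 2 - p₂) * y ^ 4
       - ℕq 120 * (p₁ ^ 3 - ℕq 3 * p₁ * p₂ + ℕq 2 * p₃) * y ^ 3
       + ℕq 30 * (p₁ ^ 4 - ℕq 6 * p₁ ^ 2 * p₂ + ℕq 3 * p₂ ^ 2 + ℕq 8 * p₁ * p₃
                  - ℕq 6 * p₄) * y ^ 2
       - ℕq 6 * (p₁ ^ 5 - ℕq 10 * p₁ ^ 3 * p₂ + ℕq 15 * p₁ * p₂ ^ 2 + ℕq 20 * p₁ ^ 2 * p₃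
                 - ℕq 20 * p₂ * p₃ - ℕq 30 * p₁ * p₄ + ℕq 24 * p₅) * y
       + ℕq 720 * (a * (b * (c * (d * (e * (f * 1ℚ))))))
newton-six a b c d e f y refl refl refl refl refl =
  solve (a ∷ b ∷ c ∷ d ∷ e ∷ f ∷ y ∷ []) ℚring

cubic : ℚ → ℚ → ℚ → ℚ → ℚ
cubic p q r Y = Y * Y * Y + p * (Y * Y) + q * Y + r

designCubic : ℚ → ℚ → ℚ
designCubic = cubic (- (+ 3 / 2)) (+ 9 / 16)

design-vanishingPolynomial : ∀ (x : Fin 6 → ℚ) → MatchesChebMoments 5 6 x →
  ∀ y → prodFin 6 (λ i → y - x i) ≡ designCubic (prodFin 6 x) (y * y)
design-vanishingPolynomial x moments y =
  sextic (x (# 0)) (x (# 1)) (x (# 2)) (x (# 3)) (x (# 4)) (x (# 5)) y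
    -- 6 · chebMoment k evaluates to 0, 3, 0, 9/4, 0
    (moments 1 (ℕP.m≤m+n 1 _)) (moments 2 (ℕP.m≤m+n 2 _)) (moments 3 (ℕP.m≤m+n 3 _))
    (moments 4 (ℕP.m≤m+n 4 _)) (moments 5 (ℕP.m≤m+n 5 _))
  where
  sextic : ∀ a b c d e f y →
    let p : ℕ → ℚ
        p k = a ^ k + (b ^ k + (c ^ k + (d ^ k + (e ^ k + (f ^ k + 0ℚ)))))
        Y = y * y
    in p 1 ≡ 0ℚ → p 2 ≡ ℕq 3 → p 3 ≡ 0ℚ → p 4 ≡ + 9 / 4 → p 5 ≡ 0ℚ →
       (y - a) * ((y - b) * ((y - c) * ((y - d) * ((y - e) * ((y - f) * 1ℚ))))) ≡
       Y * Y * Y + - (+ 3 / 2) * (Y * Y) + (+ 9 / 16) * Y + a * (b * (c * (d * (e * (f * 1ℚ)))))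
  sextic a b c d e f y p₁ p₂ p₃ p₄ p₅ = *-cancelˡ-≢0 {ℕq 720} (λ ())
    (trans (newton-six a b c d e f y p₁ p₂ p₃ p₄ p₅)
           (solve (a ∷ b ∷ c ∷ d ∷ e ∷ f ∷ y ∷ []) ℚring))

Enumerates : ∀ {n} → (Fin n → ℚ) → (ℚ → Set) → Set
Enumerates x P = (∀ i → P (x i)) × (∀ y → P y → ∃ λ i → x i ≡ y)

enumerations⇒sameSet : ∀ {n k P} {x : Fin n → ℚ} {y : Fin k → ℚ} →
  Enumerates x P → Enumerates y P → SameSet x y
enumerations⇒sameSet (Px , x-onto) (Py , y-onto) =
  (λ i → let j , yj≡xi = y-onto _ (Px i) in j , sym yj≡xi) ,
  (λ j → x-onto _ (Py j))

prodFin-enumerates : ∀ n (x : Fin n → ℚ) → Enumerates x (λ y → prodFin n (λ i → y - x i) ≡ 0ℚ)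
prodFin-enumerates n x =
  (λ i → ≡0⇒prodFin≡0 n _ i (ℚP.+-inverseʳ (x i))) ,
  (λ y ∏≡0 → let i , y-xi≡0 = prodFin≡0⇒∃≡0 n _ ∏≡0 in i , sym (p-q≡0⇒p≡q y-xi≡0))

design-enumerates : ∀ (x : Fin 6 → ℚ) → MatchesChebMoments 5 6 x →
  Enumerates x (λ y → designCubic (prodFin 6 x) (y * y) ≡ 0ℚ)
design-enumerates x moments with prodFin-enumerates 6 x
... | roots , onto =
  (λ i → trans (sym (design-vanishingPolynomial x moments (x i))) (roots i)) ,
  (λ y root → onto y (trans (design-vanishingPolynomial x moments y) root))

-- A cubic with three distinct roots

cubic-secant : ∀ p q r Y Z →
  let f X = X * X * X + p * (X * X) + q * X + r
  in f Y - f Z ≡ (Y - Z) * (Y * Y + Y * Z + Z * Z + p * (Y + Z) + q)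
cubic-secant = solve-∀ ℚring

secant-difference : ∀ p q X Y Z →
  let s U = U * U + U * Z + Z * Z + p * (U + Z) + q
  in s X - s Y ≡ (X - Y) * (X + Y + Z + p)
secant-difference = solve-∀ ℚring

signedTriple : ℚ → ℚ → ℚ → Fin 6 → ℚ
signedTriple a b c = lookup (a ∷ᵛ b ∷ᵛ c ∷ᵛ - a ∷ᵛ - b ∷ᵛ - c ∷ᵛ []ᵛ)

module DistinctRoots {p q r A B C : ℚ} (A≢B : A ≢ B) (A≢C : A ≢ C) (B≢C : B ≢ C)
  (rootA : cubic p q r A ≡ 0ℚ) (rootB : cubic p q r B ≡ 0ℚ) (rootC : cubic p q r C ≡ 0ℚ) where

  private
    p≢q⇒p-q≢0 : ∀ {X Y} → X ≢ Y → X - Y ≢ 0ℚ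
    p≢q⇒p-q≢0 X≢Y = X≢Y ∘ p-q≡0⇒p≡q

    [X-Y]*Z≡0⇒Z≡0 : ∀ {X Y Z} → X ≢ Y → (X - Y) * Z ≡ 0ℚ → Z ≡ 0ℚ
    [X-Y]*Z≡0⇒Z≡0 {X} {Y} X≢Y eq =
      *-cancelˡ-≢0 (p≢q⇒p-q≢0 X≢Y) (trans eq (sym (ℚP.*-zeroʳ (X - Y))))

    secant-zero : ∀ {Y Z} → Y ≢ Z → cubic p q r Y ≡ 0ℚ → cubic p q r Z ≡ 0ℚ →
                  Y * Y + Y * Z + Z * Z + p * (Y + Z) + q ≡ 0ℚ
    secant-zero {Y} {Z} Y≢Z rootY rootZ = [X-Y]*Z≡0⇒Z≡0 Y≢Z (begin
      (Y - Z) * (Y * Y + Y * Z + Z * Z + p * (Y + Z) + q)  ≡⟨ cubic-secant p q r Y Z ⟨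
      cubic p q r Y - cubic p q r Z                        ≡⟨ cong₂ _-_ rootY rootZ ⟩
      0ℚ                                                   ∎)

    sum+p≡0 : A + B + C + p ≡ 0ℚ
    sum+p≡0 = [X-Y]*Z≡0⇒Z≡0 A≢B (begin
      (A - B) * (A + B + C + p)
        ≡⟨ secant-difference p q A B C ⟨
      (A * A + A * C + C * C + p * (A + C) + q) - (B * B + B * C + C * C + p * (B + C) + q)
        ≡⟨ cong₂ _-_ (secant-zero A≢C rootA rootC) (secant-zero B≢C rootB rootC) ⟩
      0ℚ
        ∎)

  sum-of-roots : A + B + C ≡ - p
  sum-of-roots = inverseˡ-unique _ _ sum+p≡0

  pairSum-of-roots : A * B + B * C + C * A ≡ q
  pairSum-of-roots = sym (p-q≡0⇒p≡q (begin
    q - (A * B + B * C + C * A)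
      ≡⟨ solve (p ∷ q ∷ A ∷ B ∷ C ∷ []) ℚring ⟩
    (A * A + A * B + B * B + p * (A + B) + q) - (A + B) * (A + B + C + p)
      ≡⟨ cong₂ (λ s t → s - (A + B) * t) (secant-zero A≢B rootA rootB) sum+p≡0 ⟩
    0ℚ - (A + B) * 0ℚ
      ≡⟨ cong (_-_ 0ℚ) (ℚP.*-zeroʳ (A + B)) ⟩
    0ℚ
      ∎))

  roots-complete : ∀ {Y} → cubic p q r Y ≡ 0ℚ → Y ≡ A ⊎ Y ≡ B ⊎ Y ≡ C
  roots-complete {Y} rootY with Y ≟ A | Y ≟ B
  ... | yes Y≡A | _       = inj₁ Y≡A
  ... | no _    | yes Y≡B = inj₂ (inj₁ Y≡B)
  ... | no Y≢A  | no Y≢B  = inj₂ (inj₂ (p-q≡0⇒p≡q (begin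
    Y - C                                    ≡⟨ solve (p ∷ A ∷ B ∷ C ∷ Y ∷ []) ℚring ⟩
    (Y + B + A + p) - (A + B + C + p)        ≡⟨ cong₂ _-_ Y+B+A+p≡0 sum+p≡0 ⟩
    0ℚ                                       ∎)))
    where
    Y+B+A+p≡0 : Y + B + A + p ≡ 0ℚ
    Y+B+A+p≡0 = [X-Y]*Z≡0⇒Z≡0 Y≢B (begin
      (Y - B) * (Y + B + A + p)
        ≡⟨ secant-difference p q Y B A ⟨
      (Y * Y + Y * A + A * A + p * (Y + A) + q) - (B * B + B * A + A * A + p * (B + A) + q)
        ≡⟨ cong₂ _-_ (secant-zero Y≢A rootY rootA) (secant-zero (A≢B ∘ sym) rootB rootA) ⟩
      0ℚ
        ∎)

  signedTriple-enumerates : ∀ {a b c} → a * a ≡ A → b * b ≡ B → c * c ≡ C →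
    Enumerates (signedTriple a b c) (λ y → cubic p q r (y * y) ≡ 0ℚ)
  signedTriple-enumerates {a} {b} {c} a²≡A b²≡B c²≡C = roots , onto
    where
    root : ∀ u {X} → u * u ≡ X → cubic p q r X ≡ 0ℚ → cubic p q r (u * u) ≡ 0ℚ
    root u u²≡X rootX = trans (cong (cubic p q r) u²≡X) rootX

    roots : ∀ i → cubic p q r (signedTriple a b c i * signedTriple a b c i) ≡ 0ℚ
    roots zero                                = root a a²≡A rootA
    roots (suc zero)                          = root b b²≡B rootB
    roots (suc (suc zero))                    = root c c²≡C rootC
    roots (suc (suc (suc zero)))              = root (- a) (trans (-p*-p≡p*p a) a²≡A) rootA
    roots (suc (suc (suc (suc zero))))        = root (- b) (trans (-p*-p≡p*p b) b²≡B) rootB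
    roots (suc (suc (suc (suc (suc zero))))) = root (- c) (trans (-p*-p≡p*p c) c²≡C) rootC

    ±-index : ∀ {y} u (i i′ : Fin 6) → signedTriple a b c i ≡ u → signedTriple a b c i′ ≡ - u →
              y * y ≡ u * u → ∃ λ j → signedTriple a b c j ≡ y
    ±-index u i i′ xi≡u xi′≡-u y²≡u² =
      [ (λ y≡u → i , trans xi≡u (sym y≡u)) , (λ y≡-u → i′ , trans xi′≡-u (sym y≡-u)) ]′
        (p*p≡q*q⇒p≡±q y²≡u²)

    onto : ∀ y → cubic p q r (y * y) ≡ 0ℚ → ∃ λ j → signedTriple a b c j ≡ y
    onto y rootY with roots-complete rootY
    ... | inj₁ y²≡A         = ±-index a (# 0) (# 3) refl refl (trans y²≡A (sym a²≡A))
    ... | inj₂ (inj₁ y²≡B) = ±-index b (# 1) (# 4) refl refl (trans y²≡B (sym b²≡B))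
    ... | inj₂ (inj₂ y²≡C) = ±-index c (# 2) (# 5) refl refl (trans y²≡C (sym c²≡C))

distinct-values-bound : ∀ {n m} {x : Fin n → ℚ} → PairwiseDistinct x →
  (v : Fin m → ℚ) → (∀ i → ∃ λ j → x i ≡ v j) → n ℕ.≤ m
distinct-values-bound {x = x} distinct v covered = injective⇒≤ injective
  where
  injective : ∀ {i i′} → proj₁ (covered i) ≡ proj₁ (covered i′) → i ≡ i′
  injective {i} {i′} same = distinct i i′
    (trans (proj₂ (covered i)) (trans (cong v same) (sym (proj₂ (covered i′)))))

square-outside : ∀ {n m} {x : Fin n → ℚ} → PairwiseDistinct x →
  (v : Fin m → ℚ) → m ℕ.+ m ℕ.< n → ∃ λ i → ∀ j → x i * x i ≢ v j * v j
square-outside {n} {m} {x} distinct v 2m<n =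
  map₂ (λ ¬covered j x²≡v² → ¬covered (j , x²≡v²))
       (¬∀⟶∃¬ n _ (λ i → any? (λ j → x i * x i ≟ v j * v j)) ¬all-covered)
  where
  ±v : Fin (m ℕ.+ m) → ℚ
  ±v = v ++ (-_ ∘ v)

  signed : ∀ {i} → (∃ λ j → x i * x i ≡ v j * v j) → ∃ λ k → x i ≡ ±v k
  signed (j , x²≡v²) =
    [ (λ x≡v  → j ↑ˡ m , trans x≡v (sym (lookup-++ˡ v (-_ ∘ v) j))) ,
      (λ x≡-v → m ↑ʳ j , trans x≡-v (sym (lookup-++ʳ v (-_ ∘ v) j))) ]′
      (p*p≡q*q⇒p≡±q x²≡v²)

  ¬all-covered : ¬ (∀ i → ∃ λ j → x i * x i ≡ v j * v j)
  ¬all-covered covered = ℕP.<⇒≱ 2m<n (distinct-values-bound distinct ±v (signed ∘ covered))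

three-distinct-squares : ∀ {n} {x : Fin (5 ℕ.+ n) → ℚ} → PairwiseDistinct x →
  ∃ λ j → ∃ λ k → let A = x zero * x zero; B = x j * x j; C = x k * x k in
                  A ≢ B × A ≢ C × B ≢ C
three-distinct-squares {x = x} distinct =
  let j , B≢A  = square-outside {m = 1} distinct (λ _ → x zero) (s≤s (s≤s (s≤s z≤n)))
      k , C∉AB = square-outside {m = 2} distinct (λ { zero → x zero ; (suc _) → x j })
                                         (s≤s (s≤s (s≤s (s≤s (s≤s z≤n)))))
  in j , k , B≢A zero ∘ sym , C∉AB zero ∘ sym , C∉AB (suc zero) ∘ sym

-- The conic a + b + c = 0, a² + b² + c² = 3/2

heron : ∀ a b c →
  (a + b + c) * ((- a + b + c) * ((a - b + c) * (a + b - c))) ≡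
  ℕq 4 * (a * a * (b * b) + b * b * (c * c) + c * c * (a * a))
    - (a * a + b * b + c * c) * (a * a + b * b + c * c)
heron = solve-∀ ℚring

signed-sum-vanishes : ∀ a b c →
  (a * a + b * b + c * c) * (a * a + b * b + c * c) ≡
    ℕq 4 * (a * a * (b * b) + b * b * (c * c) + c * c * (a * a)) →
  ∃ λ α → ∃ λ β → ∃ λ γ →
    α + β + γ ≡ 0ℚ × α * α ≡ a * a × β * β ≡ b * b × γ * γ ≡ c * c
signed-sum-vanishes a b c S²≡4e₂
  with p*q≡0⇒p≡0⊎q≡0 _ _ (trans (heron a b c) (x≈y⇒x∙y⁻¹≈ε (sym S²≡4e₂)))
... | inj₁ a+b+c≡0 = a , b , c , a+b+c≡0 , refl , refl , refl
... | inj₂ rest≡0 with p*q≡0⇒p≡0⊎q≡0 _ _ rest≡0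
...   | inj₁ -a+b+c≡0 = - a , b , c , -a+b+c≡0 , -p*-p≡p*p a , refl , refl
...   | inj₂ rest′≡0 with p*q≡0⇒p≡0⊎q≡0 _ _ rest′≡0
...     | inj₁ a-b+c≡0 = a , - b , c , a-b+c≡0 , refl , -p*-p≡p*p b , refl
...     | inj₂ a+b-c≡0 = a , b , - c , a+b-c≡0 , refl , refl , -p*-p≡p*p c

record OnConic (a b c : ℚ) : Set where
  constructor onConic
  field
    sum≡0    : a + b + c ≡ 0ℚ
    squares≡ : a * a + b * b + c * c ≡ + 3 / 2

onConic-rotate : ∀ {a b c} → OnConic a b c → OnConic b c a
onConic-rotate {a} {b} {c} (onConic sum≡0 squares≡) =
  onConic (trans (rotate a b c) sum≡0) (trans (rotate (a * a) (b * b) (c * c)) squares≡)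
  where
  rotate : ∀ x y z → y + z + x ≡ x + y + z
  rotate x y z = trans (ℚP.+-comm (y + z) x) (sym (ℚP.+-assoc x y z))

onConic⇒pairSum : ∀ {a b c} → OnConic a b c →
  a * a * (b * b) + b * b * (c * c) + c * c * (a * a) ≡ + 9 / 16
onConic⇒pairSum {a} {b} {c} (onConic sum≡0 squares≡) = *-cancelˡ-≢0 {ℕq 4} (λ ()) (begin
  ℕq 4 * e₂                                  ≡⟨ p-q≡0⇒p≡q (begin
    ℕq 4 * e₂ - S * S                          ≡⟨ heron a b c ⟨
    (a + b + c) * heronRest                    ≡⟨ cong (_* heronRest) sum≡0 ⟩
    0ℚ * heronRest                             ≡⟨ ℚP.*-zeroˡ heronRest ⟩
    0ℚ                                         ∎) ⟩
  S * S                                      ≡⟨ cong (λ s → s * s) squares≡ ⟩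
  ℕq 4 * (+ 9 / 16)                          ∎)
  where
  S e₂ heronRest : ℚ
  S = a * a + b * b + c * c
  e₂ = a * a * (b * b) + b * b * (c * c) + c * c * (a * a)
  heronRest = (- a + b + c) * ((a - b + c) * (a + b - c))

onConic⇒3a²+[b-c]²≡3 : ∀ {a b c} → OnConic a b c → ℕq 3 * (a * a) + (b - c) * (b - c) ≡ ℕq 3
onConic⇒3a²+[b-c]²≡3 {a} {b} {c} (onConic sum≡0 squares≡) = begin
  ℕq 3 * (a * a) + (b - c) * (b - c)
    ≡⟨ solve (a ∷ b ∷ c ∷ []) ℚring ⟩
  ℕq 3 - ℕq 2 * (+ 3 / 2 - (a * a + b * b + c * c)) - (a + b + c) * (b + c - a)
    ≡⟨ cong₂ (λ s t → ℕq 3 - ℕq 2 * (+ 3 / 2 - s) - t * (b + c - a)) squares≡ sum≡0 ⟩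
  ℕq 3 - ℕq 2 * (+ 3 / 2 - + 3 / 2) - 0ℚ * (b + c - a)
    ≡⟨ cong (_-_ (ℕq 3 - ℕq 2 * (+ 3 / 2 - + 3 / 2))) (ℚP.*-zeroˡ (b + c - a)) ⟩
  ℕq 3
    ∎

onConic⇒inUnitInterval : ∀ {a b c} → OnConic a b c → b ≢ c → InUnitInterval a
onConic⇒inUnitInterval {a} {b} {c} conic b≢c =
  p*p<1⇒inUnitInterval (ℚP.*-cancelˡ-<-nonNeg (ℕq 3) 3a²<3)
  where
  3a²<3 : ℕq 3 * (a * a) < ℕq 3
  3a²<3 = subst₂ _<_ (ℚP.+-identityʳ (ℕq 3 * (a * a))) (onConic⇒3a²+[b-c]²≡3 conic)
            (ℚP.+-monoʳ-< (ℕq 3 * (a * a)) (0<p*p (b≢c ∘ p-q≡0⇒p≡q)))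

den≢0 : ∀ t → den t ≢ 0ℚ
den≢0 t den≡0 = ℚP.<-irrefl refl
  (ℚP.≤-<-trans (subst (0ℚ ≤_) square≡-3 (0≤p*p (ℕq 2 * t + 1ℚ))) (ℚP.negative⁻¹ _))
  where
  t²+t+1≡0 : t * t + t + 1ℚ ≡ 0ℚ
  t²+t+1≡0 = *-cancelˡ-≢0 {ℕq 14} (λ ()) (trans den≡0 (sym (ℚP.*-zeroʳ (ℕq 14))))
  square≡-3 : (ℕq 2 * t + 1ℚ) * (ℕq 2 * t + 1ℚ) ≡ ℤq (ℤ.- (+ 3))
  square≡-3 = begin
    (ℕq 2 * t + 1ℚ) * (ℕq 2 * t + 1ℚ)  ≡⟨ solve (t ∷ []) ℚring ⟩
    ℕq 4 * (t * t + t + 1ℚ) - ℕq 3     ≡⟨ cong (λ s → ℕq 4 * s - ℕq 3) t²+t+1≡0 ⟩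
    ℤq (ℤ.- (+ 3))                     ∎

parametrisation-identities : ∀ t →
  let d  = ℕq 14 * (t * t + t + 1ℚ)
      n₁ = ℕq 2 * (t * t) + ℤq (ℤ.- (+ 22)) * t + ℤq (ℤ.- (+ 13))
      n₂ = ℤq (ℤ.- (+ 13)) * (t * t) + ℤq (ℤ.- (+ 4)) * t + ℕq 11
      n₃ = ℕq 11 * (t * t) + ℕq 26 * t + ℕq 2
  in (n₁ + n₂ + n₃ ≡ d * 0ℚ) × (n₁ * n₁ + n₂ * n₂ + n₃ * n₃ ≡ (d * d) * (+ 3 / 2))
parametrisation-identities t = solve (t ∷ []) ℚring , solve (t ∷ []) ℚring

parametrisation-onConic : ∀ t → OnConic (x₁ t) (x₂ t) (x₃ t)
parametrisation-onConic t =
  onConic (*-cancelˡ-≢0 d≢0 sum≡) (*-cancelˡ-≢0 (p≢0∧q≢0⇒p*q≢0 d≢0 d≢0) squares≡)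
  where
  n₁ n₂ n₃ : ℚ
  n₁ = ℕq 2 * (t * t) + ℤq (ℤ.- (+ 22)) * t + ℤq (ℤ.- (+ 13))
  n₂ = ℤq (ℤ.- (+ 13)) * (t * t) + ℤq (ℤ.- (+ 4)) * t + ℕq 11
  n₃ = ℕq 11 * (t * t) + ℕq 26 * t + ℕq 2
  d≢0 : den t ≢ 0ℚ
  d≢0 = den≢0 t
  d*x₁ : den t * x₁ t ≡ n₁
  d*x₁ = d*[p/d]≡p n₁ d≢0
  d*x₂ : den t * x₂ t ≡ n₂
  d*x₂ = d*[p/d]≡p n₂ d≢0
  d*x₃ : den t * x₃ t ≡ n₃
  d*x₃ = d*[p/d]≡p n₃ d≢0
  distrib : ∀ d x y z → d * (x + y + z) ≡ d * x + d * y + d * z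
  distrib = solve-∀ ℚring
  distrib² : ∀ d x y z → (d * d) * (x * x + y * y + z * z) ≡
                         (d * x) * (d * x) + (d * y) * (d * y) + (d * z) * (d * z)
  distrib² = solve-∀ ℚring
  sum≡ : den t * (x₁ t + x₂ t + x₃ t) ≡ den t * 0ℚ
  sum≡ = begin
    den t * (x₁ t + x₂ t + x₃ t)              ≡⟨ distrib (den t) (x₁ t) (x₂ t) (x₃ t) ⟩
    den t * x₁ t + den t * x₂ t + den t * x₃ t ≡⟨ cong₂ _+_ (cong₂ _+_ d*x₁ d*x₂) d*x₃ ⟩
    n₁ + n₂ + n₃                               ≡⟨ proj₁ (parametrisation-identities t) ⟩
    den t * 0ℚ                                 ∎
  squares≡ : (den t * den t) * (x₁ t * x₁ t + x₂ t * x₂ t + x₃ t * x₃ t) ≡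
             (den t * den t) * (+ 3 / 2)
  squares≡ = begin
    (den t * den t) * (x₁ t * x₁ t + x₂ t * x₂ t + x₃ t * x₃ t)
      ≡⟨ distrib² (den t) (x₁ t) (x₂ t) (x₃ t) ⟩
    (den t * x₁ t) * (den t * x₁ t) + (den t * x₂ t) * (den t * x₂ t) + (den t * x₃ t) * (den t * x₃ t)
      ≡⟨ cong₂ _+_ (cong₂ _+_ (cong₂ _*_ d*x₁ d*x₁) (cong₂ _*_ d*x₂ d*x₂))
                   (cong₂ _*_ d*x₃ d*x₃) ⟩
    n₁ * n₁ + n₂ * n₂ + n₃ * n₃
      ≡⟨ proj₂ (parametrisation-identities t) ⟩
    (den t * den t) * (+ 3 / 2)
      ∎

homogeneous-quotient : ∀ {u v z x s w} → w ≢ 0ℚ →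
  u * (s * s) + v * (s * w) + z * (w * w) ≡ x * (ℕq 14 * (s * s + s * w + w * w)) →
  let t = s /q w in (u * (t * t) + v * t + z) /q den t ≡ x
homogeneous-quotient {u} {v} {z} {x} {s} {w} w≢0 N≡xD =
  ≡*⇒/q≡ (den≢0 t) (*-cancelˡ-≢0 (p≢0∧q≢0⇒p*q≢0 w≢0 w≢0) (begin
  (w * w) * (u * (t * t) + v * t + z)
    ≡⟨ homogenise u v z t w ⟩
  u * ((w * t) * (w * t)) + v * ((w * t) * w) + z * (w * w)
    ≡⟨ cong (λ σ → u * (σ * σ) + v * (σ * w) + z * (w * w)) w*t≡s ⟩
  u * (s * s) + v * (s * w) + z * (w * w)
    ≡⟨ N≡xD ⟩
  x * (ℕq 14 * (s * s + s * w + w * w))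
    ≡⟨ cong (λ σ → x * (ℕq 14 * (σ * σ + σ * w + w * w))) w*t≡s ⟨
  x * (ℕq 14 * ((w * t) * (w * t) + (w * t) * w + w * w))
    ≡⟨ homogenise-den x t w ⟨
  (w * w) * (den t * x)
    ∎))
  where
  t : ℚ
  t = s /q w
  w*t≡s : w * t ≡ s
  w*t≡s = d*[p/d]≡p s w≢0
  homogenise : ∀ u v z t w → (w * w) * (u * (t * t) + v * t + z) ≡
                             u * ((w * t) * (w * t)) + v * ((w * t) * w) + z * (w * w)
  homogenise = solve-∀ ℚring
  homogenise-den : ∀ x t w → (w * w) * (ℕq 14 * (t * t + t + 1ℚ) * x) ≡
                              x * (ℕq 14 * ((w * t) * (w * t) + (w * t) * w + w * w))
  homogenise-den = solve-∀ ℚring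

-- t = s / w is the slope parameter of the line through (a, b) and the base
-- point (1/7, −13/14), the limit of (x₁, x₂) as t → ∞; the factor
-- a² + ab + b² − 3/4 cuts out the conic in the plane a + b + c = 0.
projection-identities : ∀ a b →
  let s = - (ℕq 8 * (a - + 1 / 7) + ℕq 5 * (b + + 13 / 14))
      w = ℕq 3 * a + ℕq 8 * b + ℕq 7
      D = ℕq 14 * (s * s + s * w + w * w)
      G = a * a + a * b + b * b - + 3 / 4
  in (ℕq 2 * (s * s) + ℤq (ℤ.- (+ 22)) * (s * w) + ℤq (ℤ.- (+ 13)) * (w * w) - a * D
        ≡ (ℕq 98 - ℕq 686 * a) * G)
   × (ℤq (ℤ.- (+ 13)) * (s * s) + ℤq (ℤ.- (+ 4)) * (s * w) + ℕq 11 * (w * w) - b * D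
        ≡ (ℤq (ℤ.- (+ 686)) * b - ℕq 637) * G)
   × ((ℕq 7 * a - 1ℚ) * (ℕq 7 * a - 1ℚ) ≡ ℕq 64 * G - w * (w + ℕq 2 * a - ℕq 14))
projection-identities a b =
  solve (a ∷ b ∷ []) ℚring , solve (a ∷ b ∷ []) ℚring , solve (a ∷ b ∷ []) ℚring

onConic⇒a²+ab+b²-3/4≡0 : ∀ {a b c} → OnConic a b c → a * a + a * b + b * b - + 3 / 4 ≡ 0ℚ
onConic⇒a²+ab+b²-3/4≡0 {a} {b} {c} (onConic sum≡0 squares≡) =
  *-cancelˡ-≢0 {ℕq 2} (λ ()) (begin
  ℕq 2 * (a * a + a * b + b * b - + 3 / 4)
    ≡⟨ solve (a ∷ b ∷ c ∷ []) ℚring ⟩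
  (a * a + b * b + c * c - + 3 / 2) - (c - a - b) * (a + b + c)
    ≡⟨ cong₂ (λ S s → (S - + 3 / 2) - (c - a - b) * s) squares≡ sum≡0 ⟩
  (+ 3 / 2 - + 3 / 2) - (c - a - b) * 0ℚ
    ≡⟨ cong (_-_ (+ 3 / 2 - + 3 / 2)) (ℚP.*-zeroʳ (c - a - b)) ⟩
  ℕq 2 * 0ℚ
    ∎)

onConic⇒basePoint : ∀ {a b c} → OnConic a b c → ℕq 3 * a + ℕq 8 * b + ℕq 7 ≡ 0ℚ →
  a ≡ + 1 / 7 × b ≡ - (+ 13 / 14) × c ≡ + 11 / 14
onConic⇒basePoint {a} {b} {c} conic@(onConic sum≡0 _) w≡0 = a≡ , b≡ , c≡
  where
  7a-1≡0 : ℕq 7 * a - 1ℚ ≡ 0ℚ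
  7a-1≡0 = reduce (p*q≡0⇒p≡0⊎q≡0 (ℕq 7 * a - 1ℚ) (ℕq 7 * a - 1ℚ) (begin
    (ℕq 7 * a - 1ℚ) * (ℕq 7 * a - 1ℚ)
      ≡⟨ proj₂ (proj₂ (projection-identities a b)) ⟩
    ℕq 64 * (a * a + a * b + b * b - + 3 / 4)
      - (ℕq 3 * a + ℕq 8 * b + ℕq 7) * (ℕq 3 * a + ℕq 8 * b + ℕq 7 + ℕq 2 * a - ℕq 14)
      ≡⟨ cong₂ (λ g ω → ℕq 64 * g - ω * (ω + ℕq 2 * a - ℕq 14))
               (onConic⇒a²+ab+b²-3/4≡0 conic) w≡0 ⟩
    ℕq 64 * 0ℚ - 0ℚ * (0ℚ + ℕq 2 * a - ℕq 14)
      ≡⟨ cong (_-_ (ℕq 64 * 0ℚ)) (ℚP.*-zeroˡ (0ℚ + ℕq 2 * a - ℕq 14)) ⟩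
    0ℚ
      ∎))
  a≡ : a ≡ + 1 / 7
  a≡ = *-cancelˡ-≢0 {ℕq 7} (λ ()) (p-q≡0⇒p≡q 7a-1≡0)
  b≡ : b ≡ - (+ 13 / 14)
  b≡ = *-cancelˡ-≢0 {ℕq 8} (λ ()) (begin
    ℕq 8 * b
      ≡⟨ solve (a ∷ b ∷ []) ℚring ⟩
    (ℕq 3 * a + ℕq 8 * b + ℕq 7) - (ℕq 3 * a + ℕq 7)
      ≡⟨ cong₂ (λ ω α → ω - (ℕq 3 * α + ℕq 7)) w≡0 a≡ ⟩
    ℕq 8 * - (+ 13 / 14)
      ∎)
  c≡ : c ≡ + 11 / 14
  c≡ = trans (inverseʳ-unique (a + b) c sum≡0) (cong₂ (λ α β → - (α + β)) a≡ b≡)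

ParametrisedUpToRotation : ℚ → ℚ → ℚ → Set
ParametrisedUpToRotation a b c =
  ∃ λ t → (x₁ t ≡ a × x₂ t ≡ b × x₃ t ≡ c) ⊎ (x₁ t ≡ b × x₂ t ≡ c × x₃ t ≡ a)

onConic⇒parametrised : ∀ {a b c} → OnConic a b c → ParametrisedUpToRotation a b c
onConic⇒parametrised {a} {b} {c} conic@(onConic sum≡0 _) = by-cases (w ≟ 0ℚ)
  where
  s w : ℚ
  s = - (ℕq 8 * (a - + 1 / 7) + ℕq 5 * (b + + 13 / 14))
  w = ℕq 3 * a + ℕq 8 * b + ℕq 7

  numerator≡x*D : ∀ {N} x L →
    N - x * (ℕq 14 * (s * s + s * w + w * w)) ≡ L * (a * a + a * b + b * b - + 3 / 4) →
    N ≡ x * (ℕq 14 * (s * s + s * w + w * w))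
  numerator≡x*D x L N-xD≡LG = p-q≡0⇒p≡q
    (trans N-xD≡LG (trans (cong (L *_) (onConic⇒a²+ab+b²-3/4≡0 conic)) (ℚP.*-zeroʳ L)))

  by-cases : Dec (w ≡ 0ℚ) → ParametrisedUpToRotation a b c
  -- w = 0 only at the base point; its cyclic shift is the value at t = 0.
  by-cases (yes w≡0) = let a≡ , b≡ , c≡ = onConic⇒basePoint conic w≡0 in
    0ℚ , inj₂ (sym b≡ , sym c≡ , sym a≡)
  by-cases (no w≢0) = s /q w , inj₁ (x₁≡a , x₂≡b , x₃≡c)
    where
    x₁≡a : x₁ (s /q w) ≡ a
    x₁≡a = homogeneous-quotient {ℕq 2} {ℤq (ℤ.- (+ 22))} {ℤq (ℤ.- (+ 13))} w≢0
             (numerator≡x*D a (ℕq 98 - ℕq 686 * a) (proj₁ (projection-identities a b)))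
    x₂≡b : x₂ (s /q w) ≡ b
    x₂≡b = homogeneous-quotient {ℤq (ℤ.- (+ 13))} {ℤq (ℤ.- (+ 4))} {ℕq 11} w≢0
             (numerator≡x*D b (ℤq (ℤ.- (+ 686)) * b - ℕq 637)
                (proj₁ (proj₂ (projection-identities a b))))
    x₃≡c : x₃ (s /q w) ≡ c
    x₃≡c = begin
      x₃ (s /q w)
        ≡⟨ inverseʳ-unique _ _ (OnConic.sum≡0 (parametrisation-onConic (s /q w))) ⟩
      - (x₁ (s /q w) + x₂ (s /q w))
        ≡⟨ cong₂ (λ α β → - (α + β)) x₁≡a x₂≡b ⟩
      - (a + b)
        ≡⟨ inverseʳ-unique (a + b) c sum≡0 ⟨
      c
        ∎

-- Designs of the form ±a, ±b, ±c

signedTriple-powerSums : ∀ a b c →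
  let p : ℕ → ℚ
      p k = a ^ k + (b ^ k + (c ^ k + ((- a) ^ k + ((- b) ^ k + ((- c) ^ k + 0ℚ)))))
      S = a * a + b * b + c * c
      e₂ = a * a * (b * b) + b * b * (c * c) + c * c * (a * a)
  in p 1 ≡ 0ℚ × p 2 ≡ ℕq 2 * S × p 3 ≡ 0ℚ × p 4 ≡ ℕq 2 * (S * S - ℕq 2 * e₂) × p 5 ≡ 0ℚ
signedTriple-powerSums a b c =
  solve abc ℚring , solve abc ℚring , solve abc ℚring , solve abc ℚring , solve abc ℚring
  where
  abc : List ℚ
  abc = a ∷ b ∷ c ∷ []

signedTriple-moments : ∀ {a b c} → a * a + b * b + c * c ≡ + 3 / 2 →
  a * a * (b * b) + b * b * (c * c) + c * c * (a * a) ≡ + 9 / 16 →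
  MatchesChebMoments 5 6 (signedTriple a b c)
signedTriple-moments S≡ e₂≡ 0 _ = refl
signedTriple-moments {a} {b} {c} S≡ e₂≡ 1 _ = proj₁ (signedTriple-powerSums a b c)
signedTriple-moments {a} {b} {c} S≡ e₂≡ 2 _ =
  trans (proj₁ (proj₂ (signedTriple-powerSums a b c))) (cong (ℕq 2 *_) S≡)
signedTriple-moments {a} {b} {c} S≡ e₂≡ 3 _ = proj₁ (proj₂ (proj₂ (signedTriple-powerSums a b c)))
signedTriple-moments {a} {b} {c} S≡ e₂≡ 4 _ =
  trans (proj₁ (proj₂ (proj₂ (proj₂ (signedTriple-powerSums a b c)))))
        (cong₂ (λ S e → ℕq 2 * (S * S - ℕq 2 * e)) S≡ e₂≡)
signedTriple-moments {a} {b} {c} S≡ e₂≡ 5 _ =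
  proj₂ (proj₂ (proj₂ (proj₂ (signedTriple-powerSums a b c))))
signedTriple-moments S≡ e₂≡ (suc (suc (suc (suc (suc (suc k)))))) (s≤s (s≤s (s≤s (s≤s (s≤s ())))))

signedTriple-inUnitInterval : ∀ {a b c} → OnConic a b c → b ≢ c → c ≢ a → a ≢ b →
  ∀ i → InUnitInterval (signedTriple a b c i)
signedTriple-inUnitInterval {a} {b} {c} conic b≢c c≢a a≢b = inside
  where
  a-inside : InUnitInterval a
  a-inside = onConic⇒inUnitInterval conic b≢c
  b-inside : InUnitInterval b
  b-inside = onConic⇒inUnitInterval (onConic-rotate conic) c≢a
  c-inside : InUnitInterval c
  c-inside = onConic⇒inUnitInterval (onConic-rotate (onConic-rotate conic)) a≢b
  inside : ∀ i → InUnitInterval (signedTriple a b c i)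
  inside zero                                = a-inside
  inside (suc zero)                          = b-inside
  inside (suc (suc zero))                    = c-inside
  inside (suc (suc (suc zero)))              = neg-inUnitInterval a-inside
  inside (suc (suc (suc (suc zero))))        = neg-inUnitInterval b-inside
  inside (suc (suc (suc (suc (suc zero))))) = neg-inUnitInterval c-inside

rootSquares⇒sixPoints : ∀ {e a b c} → let A = a * a; B = b * b; C = c * c in
  A ≢ B → A ≢ C → B ≢ C →
  designCubic e A ≡ 0ℚ → designCubic e B ≡ 0ℚ → designCubic e C ≡ 0ℚ →
  ∃ λ t → Enumerates (sixPoints t) (λ y → designCubic e (y * y) ≡ 0ℚ)
rootSquares⇒sixPoints {e} {a} {b} {c} A≢B A≢C B≢C rootA rootB rootC =
  from-signs (signed-sum-vanishes a b c heron≡0)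
  where
  open DistinctRoots {p = - (+ 3 / 2)} {q = + 9 / 16} {r = e} A≢B A≢C B≢C rootA rootB rootC

  heron≡0 : (a * a + b * b + c * c) * (a * a + b * b + c * c) ≡
            ℕq 4 * (a * a * (b * b) + b * b * (c * c) + c * c * (a * a))
  heron≡0 = trans (cong (λ s → s * s) sum-of-roots) (cong (ℕq 4 *_) (sym pairSum-of-roots))

  square≡ : ∀ {x α X} → x ≡ α → α * α ≡ X → x * x ≡ X
  square≡ refl α²≡X = α²≡X

  from-signs : (∃ λ α → ∃ λ β → ∃ λ γ →
                 α + β + γ ≡ 0ℚ × α * α ≡ a * a × β * β ≡ b * b × γ * γ ≡ c * c) →
               ∃ λ t → Enumerates (sixPoints t) (λ y → designCubic e (y * y) ≡ 0ℚ)
  from-signs (α , β , γ , α+β+γ≡0 , α²≡A , β²≡B , γ²≡C) =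
    from-param (onConic⇒parametrised (onConic α+β+γ≡0
      (trans (cong₂ _+_ (cong₂ _+_ α²≡A β²≡B) γ²≡C) sum-of-roots)))
    where
    from-param : ParametrisedUpToRotation α β γ →
                 ∃ λ t → Enumerates (sixPoints t) (λ y → designCubic e (y * y) ≡ 0ℚ)
    from-param (t , inj₁ (x₁≡α , x₂≡β , x₃≡γ)) =
      t , signedTriple-enumerates
            (square≡ x₁≡α α²≡A) (square≡ x₂≡β β²≡B) (square≡ x₃≡γ γ²≡C)
    from-param (t , inj₂ (x₁≡β , x₂≡γ , x₃≡α)) =
      t , DistinctRoots.signedTriple-enumerates {p = - (+ 3 / 2)} {q = + 9 / 16} {r = e}
            B≢C (A≢B ∘ sym) (A≢C ∘ sym) rootB rootC rootA
            (square≡ x₁≡β β²≡B) (square≡ x₂≡γ γ²≡C) (square≡ x₃≡α α²≡A)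

theorem1p3 : ((x : Fin 6 → ℚ) → IsChebDesign 5 6 x → ∃ λ (t : ℚ) → SameSet x (sixPoints t))
    × ((t : ℚ) → PairwiseDistinct (sixPoints t) → IsChebDesign 5 6 (sixPoints t))
theorem1p3 = necessity , sufficiency
  where
  necessity : (x : Fin 6 → ℚ) → IsChebDesign 5 6 x → ∃ λ t → SameSet x (sixPoints t)
  necessity x design@(_ , distinct , _) =
    let j , k , A≢B , A≢C , B≢C = three-distinct-squares distinct
    in map₂ (enumerations⇒sameSet roots)
            (rootSquares⇒sixPoints {e = prodFin 6 x} {a = x zero} {b = x j} {c = x k}
               A≢B A≢C B≢C (proj₁ roots zero) (proj₁ roots j) (proj₁ roots k))
    where
    roots : Enumerates x (λ y → designCubic (prodFin 6 x) (y * y) ≡ 0ℚ)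
    roots = design-enumerates x (design⇒moments design)

  sufficiency : (t : ℚ) → PairwiseDistinct (sixPoints t) → IsChebDesign 5 6 (sixPoints t)
  sufficiency t distinct =
    signedTriple-inUnitInterval conic
      (apart (# 1) (# 2) λ ()) (apart (# 2) (# 0) λ ()) (apart (# 0) (# 1) λ ()) ,
    distinct ,
    moments⇒averages {5} {sixPoints t}
      (signedTriple-moments {x₁ t} {x₂ t} {x₃ t} (OnConic.squares≡ conic) (onConic⇒pairSum conic))
    where
    conic : OnConic (x₁ t) (x₂ t) (x₃ t)
    conic = parametrisation-onConic t
    apart : ∀ i j → i ≢ j → sixPoints t i ≢ sixPoints t j
    apart i j i≢j = i≢j ∘ distinct i j
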